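{- Let $N \ge 1$, let $D \subseteq \{0,1\}^N$, and let $f : D \rightarrow \{0,1\}$ be a Boolean function. For every $\epsilon \in (0,1/2)$, \[ \mathsf{rdeg}_\epsilon^+(f) \leq \mathsf{PostR}_\epsilon(f) \leq 2\, \mathsf{rdeg}_\epsilon^+(f). \]
   Context: A (deterministic) decision tree on input $x\in\{0,1\}^N$ adaptively queries bits $x_i$ and at a leaf outputs a value; its depth is the maximum number of queries on any path. A classical post-selected query algorithm $\mathcal{A}$ is a probability distribution over deterministic decision trees whose leaves are labelled $0$, $1$ or $\perp$ ("don't know"); on input $x$ it picks a tree from the distribution (independently of $x$) and outputs that tree's output on $x$. Its query complexity is the maximum depth of a tree in the support. For $\epsilon\in[0,1/2)$, $\mathcal{A}$ computes $f$ with error $\epsilon$ if for every $x\in D$, $\Pr[\mathcal{A}(x)\neq\perp]>0$ and $\Pr[\mathcal{A}(x)=f(x)\mid \mathcal{A}(x)\neq\perp]\ge 1-\epsilon$. $\mathsf{PostR}_\epsilon(f)$ is the minimum query complexity of a classical post-selected query algorithm computing $f$ with error $\epsilon$. A polynomial with nonnegative coefficients in the literals is a polynomial in the $2N$ variables $\{x_i, (1-x_i) : i\in[N]\}$, i.e. a nonnegative linear combination of monomials $\prod_{i\in S}x_i\prod_{j\in T}(1-x_j)$, whose degree is the maximum of $|S|+|T|$ over monomials with nonzero coefficient. A rational function with positive coefficients is $P/Q$ where $P,Q$ are such polynomials and $Q$ is nonzero on all inputs; its degree is $\max(\deg P,\deg Q)$. $P/Q$ $\epsilon$-approximates $f$ if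 $|P(x)/Q(x)-f(x)|\le\epsilon$ for all $x\in D$. $\mathsf{rdeg}^+_\epsilon(f)$ is the minimum degree of a rational function with positive coefficients that $\epsilon$-approximates $f$.
   Formalization: The parameter ε ranges over the rationals in (0,1/2), and both the probabilities of the distributions over decision trees and the coefficients of the polynomials P and Q are rational. -}

module Defs where

open import Data.Bool using (Bool; true; false; if_then_else_)
open import Data.Maybe using (Maybe; just; nothing)
open import Data.Nat as ℕ using (ℕ; zero; suc; _⊔_)
open import Data.Fin using (Fin)
open import Data.Fin.Subset using (Subset) renaming (∣_∣ to size)
open import Data.Vec using (lookup)
open import Data.List using (List; []; _∷_; allFin)
open import Data.List.Relation.Unary.All using (All)
open import Data.Product using (_×_; _,_; Σ; proj₁; proj₂)
open import Data.Rational using (ℚ; 0ℚ; 1ℚ; _+_; _*_; _-_; ∣_∣; _≤_; _<_; _÷_; ≢-nonZero)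
open import Relation.Binary.PropositionalEquality using (_≡_; _≢_; sym)
open import Data.Rational.Properties using (<⇒≢)
open import Relation.Nullary using (Dec; yes; no)

Input : ℕ → Set
Input N = Fin N → Bool

PartialFun : (N : ℕ) → (D : Input N → Set) → Set
PartialFun N D = (x : Input N) → D x → Bool

b2q : Bool → ℚ
b2q true  = 1ℚ
b2q false = 0ℚ

-- Decision trees with leaves labelled 0, 1 or ⊥ (⊥ = nothing)

data Tree (N : ℕ) : Set where
  leaf  : Maybe Bool → Tree N
  query : Fin N → Tree N → Tree N → Tree N

depth : ∀ {N} → Tree N → ℕ
depth (leaf _)        = zero
depth (query _ t₀ t₁) = suc (depth t₀ ⊔ depth t₁)

run : ∀ {N} → Tree N → Input N → Maybe Bool
run (leaf o)        x = o
run (query i t₀ t₁) x = if x i then run t₁ x else run t₀ x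

-- Classical post-selected query algorithms: finitely supported probability
-- distributions over decision trees, given as a list of (weight, tree)
-- pairs with positive rational weights summing to 1.

Alg : ℕ → Set
Alg N = List (ℚ × Tree N)

totalWeight : ∀ {N} → Alg N → ℚ
totalWeight []             = 0ℚ
totalWeight ((w , _) ∷ A) = w + totalWeight A

IsDistribution : ∀ {N} → Alg N → Set
IsDistribution A = All (λ p → 0ℚ < proj₁ p) A × totalWeight A ≡ 1ℚ

ComplexityAtMost : ∀ {N} → ℕ → Alg N → Set
ComplexityAtMost T A = All (λ p → depth (proj₂ p) ℕ.≤ T) A

eqOut : Maybe Bool → Maybe Bool → Bool
eqOut nothing      nothing      = true
eqOut (just true)  (just true)  = true
eqOut (just false) (just false) = true
eqOut _            _            = false

isDefined : Maybe Bool → Bool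
isDefined nothing  = false
isDefined (just _) = true

probOut : ∀ {N} → Alg N → Input N → Maybe Bool → ℚ
probOut []             x o = 0ℚ
probOut ((w , t) ∷ A) x o =
  (if eqOut (run t x) o then w else 0ℚ) + probOut A x o

probDefined : ∀ {N} → Alg N → Input N → ℚ
probDefined []             x = 0ℚ
probDefined ((w , t) ∷ A) x =
  (if isDefined (run t x) then w else 0ℚ) + probDefined A x

-- A computes f with error ε:  Pr[A(x) ≠ ⊥] > 0 and
-- Pr[A(x) = f(x) | A(x) ≠ ⊥] ≥ 1 - ε, i.e. (since the event A(x)=f(x)
-- is contained in A(x) ≠ ⊥)  Pr[A(x)=f(x)] / Pr[A(x)≠⊥] ≥ 1 - ε.
Computes : ∀ {N} {D : Input N → Set} → Alg N → PartialFun N D → ℚ → Set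
Computes {N} {D} A f ε =
  (x : Input N) (d : D x) →
  Σ (0ℚ < probDefined A x) λ pos →
    1ℚ - ε ≤ _÷_ (probOut A x (just (f x d))) (probDefined A x)
                 {{≢-nonZero (λ e → <⇒≢ pos (sym e))}}

PostRAtMost : ∀ {N} {D : Input N → Set} → PartialFun N D → ℚ → ℕ → Set
PostRAtMost {N} f ε T =
  Σ (Alg N) λ A → IsDistribution A × ComplexityAtMost T A × Computes A f ε

-- monomial ∏_{i∈S} x_i ∏_{j∈T} (1 - x_j), given by (S , T)
Monomial : ℕ → Set
Monomial N = Subset N × Subset N

monDegree : ∀ {N} → Monomial N → ℕ
monDegree (S , T) = size S ℕ.+ size T

prodList : ∀ {N} → (Fin N → ℚ) → List (Fin N) → ℚ
prodList g []       = 1ℚ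
prodList g (i ∷ is) = g i * prodList g is

litFactor : ∀ {N} → Monomial N → Input N → Fin N → ℚ
litFactor (S , T) x i =
  (if lookup S i then b2q (x i) else 1ℚ) *
  (if lookup T i then (1ℚ - b2q (x i)) else 1ℚ)

evalMon : ∀ {N} → Monomial N → Input N → ℚ
evalMon {N} m x = prodList (litFactor m x) (allFin N)

Poly : ℕ → Set
Poly N = List (ℚ × Monomial N)

evalPoly : ∀ {N} → Poly N → Input N → ℚ
evalPoly []             x = 0ℚ
evalPoly ((c , m) ∷ P) x = c * evalMon m x + evalPoly P x

NonnegCoeffs : ∀ {N} → Poly N → Set
NonnegCoeffs P = All (λ p → 0ℚ ≤ proj₁ p) P

PolyDegreeAtMost : ∀ {N} → ℕ → Poly N → Set
PolyDegreeAtMost d P = All (λ p → monDegree (proj₂ p) ℕ.≤ d) P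

RdegAtMost : ∀ {N} {D : Input N → Set} → PartialFun N D → ℚ → ℕ → Set
RdegAtMost {N} {D} f ε d =
  Σ (Poly N) λ P → Σ (Poly N) λ Q →
    NonnegCoeffs P × NonnegCoeffs Q ×
    PolyDegreeAtMost d P × PolyDegreeAtMost d Q ×
    Σ ((x : Input N) → evalPoly Q x ≢ 0ℚ) λ Qnz →
      (x : Input N) (dx : D x) →
        ∣ _÷_ (evalPoly P x) (evalPoly Q x) {{≢-nonZero (Qnz x)}} - b2q (f x dx) ∣ ≤ ε

{-# OPTIONS --safe #-}
-- A post-selected algorithm of depth T gives the polynomials p_o(x) = Pr[A(x) = o], of degree
-- at most T with nonnegative coefficients: each root-to-leaf path of a tree is a monomial in the
-- literals.  On D the error condition reads p_{f(x)} ≥ (1 - ε)(p₁ + p₀), and then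
-- (1 - ε)(1 + ε) p₁ / ((1 - ε) p₁ + p₀ + δ p⊥) is within ε of f.  The term δ p⊥ keeps the
-- denominator positive on all of {0,1}^N; with δ = ε(1 - 2ε)·(least weight of A) it fits in
-- the slack left by ε < 1/2, because p₁ + p₀ is at least that weight wherever it is positive.
--
-- Conversely, given P/Q within ε of f, pick for every monomial of P² (resp. ε(1 - ε) Q²), with
-- probability proportional to its coefficient, a tree that answers 1 (resp. 0) if the monomial
-- is 1 and ⊥ otherwise, and let a ⊥-leaf take the remaining weight.  Then
-- Pr[1] : Pr[0] = P² : ε(1 - ε) Q², and |P/Q - f| ≤ ε gives conditional error at most ε.
-- Squaring, which doubles the degree, is needed: no weight c on Q makes P : c Q work for
-- both values of f.
module Submission where

open import Defs
import Algebra.Properties.CommutativeSemigroup as CommutativeSemigroupProperties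
open import Algebra.Bundles using (CommutativeMonoid)
open import Data.Bool using (Bool; true; false; not; _∧_; _∨_; if_then_else_)
open import Data.Bool.Properties using (∧-commutativeMonoid; if-∧; if-float; if-eta)
open import Data.Empty using (⊥-elim)
open import Data.Fin using (Fin; zero; suc)
open import Data.Fin.Subset using (Subset; _∪_; ⁅_⁆) renaming (⊥ to ∅; ∣_∣ to size)
open import Data.Fin.Subset.Properties using (∣⊥∣≡0; ∣⁅x⁆∣≡1; ∣p∣≤∣x∷p∣)
open import Data.List using ([]; _∷_; _++_; map; filter; tabulate; allFin; cartesianProductWith)
open import Data.List.Relation.Unary.All as All using (All; []; _∷_)
open import Data.List.Relation.Unary.All.Properties
  using (++⁺; map⁺; filter⁺; all-filter; cartesianProductWith⁺)
open import Data.Maybe using (Maybe; just; nothing)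
open import Data.Nat as ℕ using (ℕ; zero; suc; z≤n; s≤s)
import Data.Nat.Properties as ℕₚ
open import Data.Product using (_×_; _,_; proj₁; proj₂; map₁; map₂)
open import Data.Rational
open import Data.Rational.Properties
open import Data.Sum using (inj₁; inj₂)
open import Data.Vec using ([]; _∷_)
open import Function using (_∘_; id)
open import Level using (0ℓ)
open import Relation.Binary.PropositionalEquality
open import Relation.Nullary using (¬?; yes; no)
open import Relation.Nullary.Decidable using (dec⇒maybe)
open import Tactic.RingSolver using (solve-∀)
open import Tactic.RingSolver.Core.AlmostCommutativeRing
  using (AlmostCommutativeRing; fromCommutativeRing)

open CommutativeSemigroupProperties (CommutativeMonoid.commutativeSemigroup ∧-commutativeMonoid)
  using () renaming (interchange to ∧-interchange)
open CommutativeSemigroupProperties ℕₚ.+-commutativeSemigroup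
  using () renaming (interchange to ℕ-+-interchange)
open CommutativeSemigroupProperties (CommutativeMonoid.commutativeSemigroup +-0-commutativeMonoid)
  using () renaming (interchange to +-interchange)

-- Rational arithmetic

ℚ-ring : AlmostCommutativeRing 0ℓ 0ℓ
ℚ-ring = fromCommutativeRing +-*-commutativeRing (λ p → dec⇒maybe (0ℚ ≟ p))

≤-by-difference : ∀ {p q} r → q - p ≡ r → 0ℚ ≤ r → p ≤ q
≤-by-difference {p} {q} r q-p≡r 0≤r = begin
  p          ≡⟨ +-identityˡ p ⟨
  0ℚ + p     ≤⟨ +-monoˡ-≤ p 0≤r ⟩
  r + p      ≡⟨ cong (_+ p) q-p≡r ⟨
  q - p + p  ≡⟨ cancel q p ⟩
  q          ∎
  where
  open ≤-Reasoning
  cancel : ∀ q p → q - p + p ≡ q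
  cancel = solve-∀ ℚ-ring

p≤q⇒0≤q-p : ∀ {p q} → p ≤ q → 0ℚ ≤ q - p
p≤q⇒0≤q-p {p} {q} p≤q = subst (_≤ q - p) (+-inverseʳ p) (+-monoˡ-≤ (- p) p≤q)

p<q⇒0<q-p : ∀ {p q} → p < q → 0ℚ < q - p
p<q⇒0<q-p {p} {q} p<q = subst (_< q - p) (+-inverseʳ p) (+-monoˡ-< (- p) p<q)

0≤p+q : ∀ {p q} → 0ℚ ≤ p → 0ℚ ≤ q → 0ℚ ≤ p + q
0≤p+q = +-mono-≤

0<p+q : ∀ {p q} → 0ℚ ≤ p → 0ℚ < q → 0ℚ < p + q
0<p+q = +-mono-≤-<

0≤p*q : ∀ {p q} → 0ℚ ≤ p → 0ℚ ≤ q → 0ℚ ≤ p * q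
0≤p*q {p} {q} 0≤p 0≤q =
  nonNegative⁻¹ (p * q) {{nonNeg*nonNeg⇒nonNeg p {{nonNegative 0≤p}} q {{nonNegative 0≤q}}}}

0<p*q : ∀ {p q} → 0ℚ < p → 0ℚ < q → 0ℚ < p * q
0<p*q {p} {q} 0<p 0<q = positive⁻¹ (p * q) {{pos*pos⇒pos p {{positive 0<p}} q {{positive 0<q}}}}

0≤p∧p≢0⇒0<p : ∀ {p} → 0ℚ ≤ p → p ≢ 0ℚ → 0ℚ < p
0≤p∧p≢0⇒0<p {p} 0≤p p≢0 = positive⁻¹ p {{nonNeg∧nonZero⇒pos p {{nonNegative 0≤p}} {{≢-nonZero p≢0}}}}

p÷s*s≡p : ∀ p s .{{_ : NonZero s}} → (p ÷ s) * s ≡ p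
p÷s*s≡p p s = trans (*-assoc p (1/ s) s) (trans (cong (p *_) (*-inverseˡ s)) (*-identityʳ p))

*≤⇒≤÷ : ∀ {q p s} .{{_ : NonZero s}} → 0ℚ < s → q * s ≤ p → q ≤ p ÷ s
*≤⇒≤÷ {q} {p} {s} 0<s qs≤p = *-cancelʳ-≤-pos s {{positive 0<s}} (subst (q * s ≤_) (sym (p÷s*s≡p p s)) qs≤p)

≤*⇒÷≤ : ∀ {q p s} .{{_ : NonZero s}} → 0ℚ < s → p ≤ q * s → p ÷ s ≤ q
≤*⇒÷≤ {q} {p} {s} 0<s p≤qs = *-cancelʳ-≤-pos s {{positive 0<s}} (subst (_≤ q * s) (sym (p÷s*s≡p p s)) p≤qs)

≤÷⇒*≤ : ∀ {q p s} .{{_ : NonZero s}} → 0ℚ < s → q ≤ p ÷ s → q * s ≤ p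
≤÷⇒*≤ {q} {p} {s} 0<s q≤p÷s =
  subst (q * s ≤_) (p÷s*s≡p p s) (*-monoʳ-≤-nonNeg s {{nonNegative (<⇒≤ 0<s)}} q≤p÷s)

÷≤⇒≤* : ∀ {q p s} .{{_ : NonZero s}} → 0ℚ < s → p ÷ s ≤ q → p ≤ q * s
÷≤⇒≤* {q} {p} {s} 0<s p÷s≤q =
  subst (_≤ q * s) (p÷s*s≡p p s) (*-monoʳ-≤-nonNeg s {{nonNegative (<⇒≤ 0<s)}} p÷s≤q)

p≤∣p∣ : ∀ p → p ≤ ∣ p ∣
p≤∣p∣ p with ∣p∣≡p∨∣p∣≡-p p
... | inj₁ ∣p∣≡p  = ≤-reflexive (sym ∣p∣≡p)
... | inj₂ ∣p∣≡-p = ≤-trans p≤0 (0≤∣p∣ p)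
  where
  p≤0 : p ≤ 0ℚ
  p≤0 = ≤-by-difference (- p) (+-identityˡ (- p)) (subst (0ℚ ≤_) ∣p∣≡-p (0≤∣p∣ p))

-p≤∣p∣ : ∀ p → - p ≤ ∣ p ∣
-p≤∣p∣ p = subst (- p ≤_) (∣-p∣≡∣p∣ p) (p≤∣p∣ (- p))

∣p-q∣≤r⇒p≤q+r : ∀ {p q r} → ∣ p - q ∣ ≤ r → p ≤ q + r
∣p-q∣≤r⇒p≤q+r {p} {q} {r} h =
  ≤-by-difference (r - (p - q)) (rearrange p q r) (p≤q⇒0≤q-p (≤-trans (p≤∣p∣ (p - q)) h))
  where
  rearrange : ∀ p q r → q + r - p ≡ r - (p - q)
  rearrange = solve-∀ ℚ-ring

∣p-q∣≤r⇒q-r≤p : ∀ {p q r} → ∣ p - q ∣ ≤ r → q - r ≤ p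
∣p-q∣≤r⇒q-r≤p {p} {q} {r} h =
  ≤-by-difference (r - (- (p - q))) (rearrange p q r) (p≤q⇒0≤q-p (≤-trans (-p≤∣p∣ (p - q)) h))
  where
  rearrange : ∀ p q r → p - (q - r) ≡ r - (- (p - q))
  rearrange = solve-∀ ℚ-ring

q-r≤p≤q+r⇒∣p-q∣≤r : ∀ {p q r} → q - r ≤ p → p ≤ q + r → ∣ p - q ∣ ≤ r
q-r≤p≤q+r⇒∣p-q∣≤r {p} {q} {r} lower upper with ∣p∣≡p∨∣p∣≡-p (p - q)
... | inj₁ ∣d∣≡d  = subst (_≤ r) (sym ∣d∣≡d)
  (≤-by-difference (q + r - p) (rearrange₁ p q r) (p≤q⇒0≤q-p upper))
  where
  rearrange₁ : ∀ p q r → r - (p - q) ≡ q + r - p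
  rearrange₁ = solve-∀ ℚ-ring
... | inj₂ ∣d∣≡-d = subst (_≤ r) (sym ∣d∣≡-d)
  (≤-by-difference (p - (q - r)) (rearrange₂ p q r) (p≤q⇒0≤q-p lower))
  where
  rearrange₂ : ∀ p q r → r - (- (p - q)) ≡ p - (q - r)
  rearrange₂ = solve-∀ ℚ-ring

[q-r]s≤p≤[q+r]s⇒∣p÷s-q∣≤r : ∀ {p q r s} .{{_ : NonZero s}} → 0ℚ < s →
  (q - r) * s ≤ p → p ≤ (q + r) * s → ∣ p ÷ s - q ∣ ≤ r
[q-r]s≤p≤[q+r]s⇒∣p÷s-q∣≤r 0<s lower upper =
  q-r≤p≤q+r⇒∣p-q∣≤r (*≤⇒≤÷ 0<s lower) (≤*⇒÷≤ 0<s upper)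

∣p÷s-q∣≤r⇒[q-r]s≤p : ∀ {p q r s} .{{_ : NonZero s}} → 0ℚ < s → ∣ p ÷ s - q ∣ ≤ r → (q - r) * s ≤ p
∣p÷s-q∣≤r⇒[q-r]s≤p 0<s h = ≤÷⇒*≤ 0<s (∣p-q∣≤r⇒q-r≤p h)

∣p÷s-q∣≤r⇒p≤[q+r]s : ∀ {p q r s} .{{_ : NonZero s}} → 0ℚ < s → ∣ p ÷ s - q ∣ ≤ r → p ≤ (q + r) * s
∣p÷s-q∣≤r⇒p≤[q+r]s 0<s h = ÷≤⇒≤* 0<s (∣p-q∣≤r⇒p≤q+r h)

-- Monomials as conjunctions of literals

b2q-∧ : ∀ a b → b2q (a ∧ b) ≡ b2q a * b2q b
b2q-∧ true  b = sym (*-identityˡ (b2q b))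
b2q-∧ false b = sym (*-zeroˡ (b2q b))

0≤b2q : ∀ b → 0ℚ ≤ b2q b
0≤b2q true  = nonNegative⁻¹ 1ℚ
0≤b2q false = ≤-refl

p*b2q[b]≡if : ∀ p b → p * b2q b ≡ (if b then p else 0ℚ)
p*b2q[b]≡if p true  = *-identityʳ p
p*b2q[b]≡if p false = *-zeroʳ p

literalHolds : (inS inT xᵢ : Bool) → Bool
literalHolds inS inT true  = not inT
literalHolds inS inT false = not inS

literalHolds-absent : ∀ b → literalHolds false false b ≡ true
literalHolds-absent true  = refl
literalHolds-absent false = refl

literalHolds-∨ : ∀ s t s′ t′ b →
  literalHolds (s ∨ s′) (t ∨ t′) b ≡ literalHolds s t b ∧ literalHolds s′ t′ b
literalHolds-∨ s     true  s′ t′ true  = refl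
literalHolds-∨ s     false s′ t′ true  = refl
literalHolds-∨ true  t     s′ t′ false = refl
literalHolds-∨ false t     s′ t′ false = refl

litFactor≡b2q∘literalHolds : ∀ s t b →
  (if s then b2q b else 1ℚ) * (if t then 1ℚ - b2q b else 1ℚ) ≡ b2q (literalHolds s t b)
litFactor≡b2q∘literalHolds true  true  true  = refl
litFactor≡b2q∘literalHolds true  true  false = refl
litFactor≡b2q∘literalHolds true  false true  = refl
litFactor≡b2q∘literalHolds true  false false = refl
litFactor≡b2q∘literalHolds false true  true  = refl
litFactor≡b2q∘literalHolds false true  false = refl
litFactor≡b2q∘literalHolds false false true  = refl
litFactor≡b2q∘literalHolds false false false = refl

satisfies : ∀ {N} → Monomial N → Input N → Bool
satisfies {zero}  _               _ = true
satisfies {suc N} (s ∷ S , t ∷ T) x = literalHolds s t (x zero) ∧ satisfies (S , T) (x ∘ suc)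

prodList-tabulate : ∀ {n N} (g : Fin N → ℚ) (h : Fin n → Fin N) →
  prodList g (tabulate h) ≡ prodList (g ∘ h) (allFin n)
prodList-tabulate {zero}  g h = refl
prodList-tabulate {suc n} g h =
  cong (g (h zero) *_) (trans (prodList-tabulate g (h ∘ suc)) (sym (prodList-tabulate (g ∘ h) suc)))

evalMon≡b2q∘satisfies : ∀ {N} (m : Monomial N) x → evalMon m x ≡ b2q (satisfies m x)
evalMon≡b2q∘satisfies {zero}  _                   _ = refl
evalMon≡b2q∘satisfies {suc N} m@(s ∷ S , t ∷ T) x = begin
  litFactor m x zero * prodList (litFactor m x) (tabulate suc)
    ≡⟨ cong (litFactor m x zero *_) (prodList-tabulate (litFactor m x) suc) ⟩
  litFactor m x zero * evalMon (S , T) (x ∘ suc)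
    ≡⟨ cong₂ _*_ (litFactor≡b2q∘literalHolds s t (x zero)) (evalMon≡b2q∘satisfies (S , T) (x ∘ suc)) ⟩
  b2q (literalHolds s t (x zero)) * b2q (satisfies (S , T) (x ∘ suc))
    ≡⟨ b2q-∧ (literalHolds s t (x zero)) (satisfies (S , T) (x ∘ suc)) ⟨
  b2q (satisfies m x) ∎
  where open ≡-Reasoning

0≤evalMon : ∀ {N} (m : Monomial N) x → 0ℚ ≤ evalMon m x
0≤evalMon m x = subst (0ℚ ≤_) (sym (evalMon≡b2q∘satisfies m x)) (0≤b2q (satisfies m x))

_·_ : ∀ {N} → Monomial N → Monomial N → Monomial N
(S , T) · (S′ , T′) = S ∪ S′ , T ∪ T′

satisfies-· : ∀ {N} (m m′ : Monomial N) x → satisfies (m · m′) x ≡ satisfies m x ∧ satisfies m′ x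
satisfies-· {zero}  _               _                   _ = refl
satisfies-· {suc N} (s ∷ S , t ∷ T) (s′ ∷ S′ , t′ ∷ T′) x =
  trans (cong₂ _∧_ (literalHolds-∨ s t s′ t′ (x zero)) (satisfies-· (S , T) (S′ , T′) (x ∘ suc)))
        (∧-interchange (literalHolds s t (x zero)) (literalHolds s′ t′ (x zero))
                       (satisfies (S , T) (x ∘ suc)) (satisfies (S′ , T′) (x ∘ suc)))

evalMon-· : ∀ {N} (m m′ : Monomial N) x → evalMon (m · m′) x ≡ evalMon m x * evalMon m′ x
evalMon-· m m′ x = begin
  evalMon (m · m′) x                        ≡⟨ evalMon≡b2q∘satisfies (m · m′) x ⟩
  b2q (satisfies (m · m′) x)                ≡⟨ cong b2q (satisfies-· m m′ x) ⟩
  b2q (satisfies m x ∧ satisfies m′ x)      ≡⟨ b2q-∧ (satisfies m x) (satisfies m′ x) ⟩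
  b2q (satisfies m x) * b2q (satisfies m′ x) ≡⟨ cong₂ _*_ (evalMon≡b2q∘satisfies m x) (evalMon≡b2q∘satisfies m′ x) ⟨
  evalMon m x * evalMon m′ x                ∎
  where open ≡-Reasoning

∣p∪q∣≤∣p∣+∣q∣ : ∀ {n} (p q : Subset n) → size (p ∪ q) ℕ.≤ size p ℕ.+ size q
∣p∪q∣≤∣p∣+∣q∣ []          []          = z≤n
∣p∪q∣≤∣p∣+∣q∣ (true  ∷ p) (b     ∷ q) =
  s≤s (ℕₚ.≤-trans (∣p∪q∣≤∣p∣+∣q∣ p q) (ℕₚ.+-monoʳ-≤ (size p) (∣p∣≤∣x∷p∣ b q)))
∣p∪q∣≤∣p∣+∣q∣ (false ∷ p) (true  ∷ q) =
  subst (size (p ∪ q) ℕ.<_) (sym (ℕₚ.+-suc (size p) (size q))) (s≤s (∣p∪q∣≤∣p∣+∣q∣ p q))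
∣p∪q∣≤∣p∣+∣q∣ (false ∷ p) (false ∷ q) = ∣p∪q∣≤∣p∣+∣q∣ p q

monDegree-· : ∀ {N} (m m′ : Monomial N) → monDegree (m · m′) ℕ.≤ monDegree m ℕ.+ monDegree m′
monDegree-· (S , T) (S′ , T′) =
  ℕₚ.≤-trans (ℕₚ.+-mono-≤ (∣p∪q∣≤∣p∣+∣q∣ S S′) (∣p∪q∣≤∣p∣+∣q∣ T T′))
             (ℕₚ.≤-reflexive (ℕ-+-interchange (size S) (size S′) (size T) (size T′)))

unitMonomial : ∀ {N} → Monomial N
unitMonomial = ∅ , ∅

positiveLiteral negativeLiteral : ∀ {N} → Fin N → Monomial N
positiveLiteral i = ⁅ i ⁆ , ∅
negativeLiteral i = ∅ , ⁅ i ⁆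

satisfies-unitMonomial : ∀ {N} (x : Input N) → satisfies unitMonomial x ≡ true
satisfies-unitMonomial {zero}  x = refl
satisfies-unitMonomial {suc N} x rewrite literalHolds-absent (x zero) = satisfies-unitMonomial (x ∘ suc)

satisfies-positiveLiteral : ∀ {N} (i : Fin N) x → satisfies (positiveLiteral i) x ≡ x i
satisfies-positiveLiteral zero x rewrite satisfies-unitMonomial (x ∘ suc) with x zero
... | true  = refl
... | false = refl
satisfies-positiveLiteral (suc i) x rewrite literalHolds-absent (x zero) =
  satisfies-positiveLiteral i (x ∘ suc)

satisfies-negativeLiteral : ∀ {N} (i : Fin N) x → satisfies (negativeLiteral i) x ≡ not (x i)
satisfies-negativeLiteral zero x rewrite satisfies-unitMonomial (x ∘ suc) with x zero
... | true  = refl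
... | false = refl
satisfies-negativeLiteral (suc i) x rewrite literalHolds-absent (x zero) =
  satisfies-negativeLiteral i (x ∘ suc)

monDegree-unitMonomial : ∀ {N} → monDegree (unitMonomial {N}) ≡ 0
monDegree-unitMonomial {N} = cong₂ ℕ._+_ (∣⊥∣≡0 N) (∣⊥∣≡0 N)

monDegree-positiveLiteral : ∀ {N} (i : Fin N) → monDegree (positiveLiteral i) ≡ 1
monDegree-positiveLiteral {N} i = cong₂ ℕ._+_ (∣⁅x⁆∣≡1 i) (∣⊥∣≡0 N)

monDegree-negativeLiteral : ∀ {N} (i : Fin N) → monDegree (negativeLiteral i) ≡ 1
monDegree-negativeLiteral {N} i = cong₂ ℕ._+_ (∣⊥∣≡0 N) (∣⁅x⁆∣≡1 i)

-- Polynomials with nonnegative coefficients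

term : ∀ {N} → Monomial N → Poly N
term m = (1ℚ , m) ∷ []

scale : ∀ {N} → ℚ → Poly N → Poly N
scale k = map (map₁ (k *_))

_*ₚ_ : ∀ {N} → Poly N → Poly N → Poly N
_*ₚ_ = cartesianProductWith λ (c , m) (c′ , m′) → c * c′ , m · m′

coeffSum : ∀ {N} → Poly N → ℚ
coeffSum []            = 0ℚ
coeffSum ((c , _) ∷ P) = c + coeffSum P

evalPoly-++ : ∀ {N} (P Q : Poly N) x → evalPoly (P ++ Q) x ≡ evalPoly P x + evalPoly Q x
evalPoly-++ []            Q x = sym (+-identityˡ (evalPoly Q x))
evalPoly-++ ((c , m) ∷ P) Q x =
  trans (cong (c * evalMon m x +_) (evalPoly-++ P Q x))
        (sym (+-assoc (c * evalMon m x) (evalPoly P x) (evalPoly Q x)))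

evalPoly-term : ∀ {N} (m : Monomial N) x → evalPoly (term m) x ≡ evalMon m x
evalPoly-term m x = trans (+-identityʳ (1ℚ * evalMon m x)) (*-identityˡ (evalMon m x))

evalPoly-scale : ∀ {N} k (P : Poly N) x → evalPoly (scale k P) x ≡ k * evalPoly P x
evalPoly-scale k []            x = sym (*-zeroʳ k)
evalPoly-scale k ((c , m) ∷ P) x =
  trans (cong (k * c * evalMon m x +_) (evalPoly-scale k P x)) (distribute k c (evalMon m x) (evalPoly P x))
  where
  distribute : ∀ k c e r → k * c * e + k * r ≡ k * (c * e + r)
  distribute = solve-∀ ℚ-ring

evalPoly-*ₚ : ∀ {N} (P Q : Poly N) x → evalPoly (P *ₚ Q) x ≡ evalPoly P x * evalPoly Q x
evalPoly-*ₚ []            Q x = sym (*-zeroˡ (evalPoly Q x))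
evalPoly-*ₚ ((c , m) ∷ P) Q x = begin
  evalPoly (map (λ (c′ , m′) → c * c′ , m · m′) Q ++ P *ₚ Q) x
    ≡⟨ evalPoly-++ (map _ Q) (P *ₚ Q) x ⟩
  evalPoly (map (λ (c′ , m′) → c * c′ , m · m′) Q) x + evalPoly (P *ₚ Q) x
    ≡⟨ cong₂ _+_ (evalPoly-termTimes Q) (evalPoly-*ₚ P Q x) ⟩
  c * evalMon m x * evalPoly Q x + evalPoly P x * evalPoly Q x
    ≡⟨ *-distribʳ-+ (evalPoly Q x) (c * evalMon m x) (evalPoly P x) ⟨
  (c * evalMon m x + evalPoly P x) * evalPoly Q x ∎
  where
  open ≡-Reasoning
  regroup : ∀ c c′ e e′ r → c * c′ * (e * e′) + c * e * r ≡ c * e * (c′ * e′ + r)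
  regroup = solve-∀ ℚ-ring
  evalPoly-termTimes : ∀ Q → evalPoly (map (λ (c′ , m′) → c * c′ , m · m′) Q) x ≡ c * evalMon m x * evalPoly Q x
  evalPoly-termTimes []              = sym (*-zeroʳ (c * evalMon m x))
  evalPoly-termTimes ((c′ , m′) ∷ Q) =
    trans (cong₂ (λ e r → c * c′ * e + r) (evalMon-· m m′ x) (evalPoly-termTimes Q))
          (regroup c c′ (evalMon m x) (evalMon m′ x) (evalPoly Q x))

0≤evalPoly : ∀ {N} (P : Poly N) → NonnegCoeffs P → ∀ x → 0ℚ ≤ evalPoly P x
0≤evalPoly []            []         x = ≤-refl
0≤evalPoly ((c , m) ∷ P) (0≤c ∷ nn) x = 0≤p+q (0≤p*q 0≤c (0≤evalMon m x)) (0≤evalPoly P nn x)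

0≤coeffSum : ∀ {N} (P : Poly N) → NonnegCoeffs P → 0ℚ ≤ coeffSum P
0≤coeffSum []            []         = ≤-refl
0≤coeffSum ((c , m) ∷ P) (0≤c ∷ nn) = 0≤p+q 0≤c (0≤coeffSum P nn)

coeffSum-scale : ∀ {N} k (P : Poly N) → coeffSum (scale k P) ≡ k * coeffSum P
coeffSum-scale k []            = sym (*-zeroʳ k)
coeffSum-scale k ((c , m) ∷ P) =
  trans (cong (k * c +_) (coeffSum-scale k P)) (sym (*-distribˡ-+ k c (coeffSum P)))

nonNeg-term : ∀ {N} (m : Monomial N) → NonnegCoeffs (term m)
nonNeg-term m = nonNegative⁻¹ 1ℚ ∷ []

nonNeg-scale : ∀ {N k} {P : Poly N} → 0ℚ ≤ k → NonnegCoeffs P → NonnegCoeffs (scale k P)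
nonNeg-scale 0≤k nn = map⁺ (All.map (0≤p*q 0≤k) nn)

nonNeg-*ₚ : ∀ {N} {P Q : Poly N} → NonnegCoeffs P → NonnegCoeffs Q → NonnegCoeffs (P *ₚ Q)
nonNeg-*ₚ {P = P} {Q} nnP nnQ =
  cartesianProductWith⁺ (setoid _) (setoid _) _ P Q
    (λ c∈P c′∈Q → 0≤p*q (All.lookup nnP c∈P) (All.lookup nnQ c′∈Q))

degree-term : ∀ {N} (m : Monomial N) → PolyDegreeAtMost (monDegree m) (term m)
degree-term m = ℕₚ.≤-refl ∷ []

degree-mono : ∀ {N d e} {P : Poly N} → d ℕ.≤ e → PolyDegreeAtMost d P → PolyDegreeAtMost e P
degree-mono d≤e = All.map (λ deg≤d → ℕₚ.≤-trans deg≤d d≤e)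

degree-scale : ∀ {N d k} {P : Poly N} → PolyDegreeAtMost d P → PolyDegreeAtMost d (scale k P)
degree-scale = map⁺

degree-*ₚ : ∀ {N d e} {P Q : Poly N} →
  PolyDegreeAtMost d P → PolyDegreeAtMost e Q → PolyDegreeAtMost (d ℕ.+ e) (P *ₚ Q)
degree-*ₚ {P = P} {Q} degP degQ =
  cartesianProductWith⁺ (setoid _) (setoid _) _ P Q
    (λ {(_ , m)} {(_ , m′)} m∈P m′∈Q →
      ℕₚ.≤-trans (monDegree-· m m′) (ℕₚ.+-mono-≤ (All.lookup degP m∈P) (All.lookup degQ m′∈Q)))

-- From algorithms to rational functions

treePoly : ∀ {N} → Tree N → Maybe Bool → Poly N
treePoly (leaf o′)       o = if eqOut o′ o then term unitMonomial else []
treePoly (query i t₀ t₁) o =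
  term (negativeLiteral i) *ₚ treePoly t₀ o ++ term (positiveLiteral i) *ₚ treePoly t₁ o

evalPoly-treePoly : ∀ {N} (t : Tree N) o x → evalPoly (treePoly t o) x ≡ b2q (eqOut (run t x) o)
evalPoly-treePoly (leaf o′) o x with eqOut o′ o
... | true  = trans (evalPoly-term unitMonomial x)
                    (trans (evalMon≡b2q∘satisfies unitMonomial x) (cong b2q (satisfies-unitMonomial x)))
... | false = refl
evalPoly-treePoly (query i t₀ t₁) o x = begin
  evalPoly (term (negativeLiteral i) *ₚ treePoly t₀ o ++ term (positiveLiteral i) *ₚ treePoly t₁ o) x
    ≡⟨ evalPoly-++ (term (negativeLiteral i) *ₚ treePoly t₀ o) _ x ⟩
  evalPoly (term (negativeLiteral i) *ₚ treePoly t₀ o) x + evalPoly (term (positiveLiteral i) *ₚ treePoly t₁ o) x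
    ≡⟨ cong₂ _+_ (branch (negativeLiteral i) t₀ (satisfies-negativeLiteral i x))
                 (branch (positiveLiteral i) t₁ (satisfies-positiveLiteral i x)) ⟩
  b2q (not (x i)) * b2q (eqOut (run t₀ x) o) + b2q (x i) * b2q (eqOut (run t₁ x) o)
    ≡⟨ select (x i) _ _ ⟩
  (if x i then b2q (eqOut (run t₁ x) o) else b2q (eqOut (run t₀ x) o))
    ≡⟨ if-float (λ r → b2q (eqOut r o)) (x i) ⟨
  b2q (eqOut (run (query i t₀ t₁) x) o) ∎
  where
  open ≡-Reasoning
  branch : ∀ m t {b} → satisfies m x ≡ b →
    evalPoly (term m *ₚ treePoly t o) x ≡ b2q b * b2q (eqOut (run t x) o)
  branch m t refl = begin
    evalPoly (term m *ₚ treePoly t o) x              ≡⟨ evalPoly-*ₚ (term m) (treePoly t o) x ⟩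
    evalPoly (term m) x * evalPoly (treePoly t o) x  ≡⟨ cong₂ _*_ (trans (evalPoly-term m x) (evalMon≡b2q∘satisfies m x))
                                                                  (evalPoly-treePoly t o x) ⟩
    b2q (satisfies m x) * b2q (eqOut (run t x) o)    ∎
  select : ∀ b u v → b2q (not b) * u + b2q b * v ≡ (if b then v else u)
  select true  u v = trans (cong₂ _+_ (*-zeroˡ u) (*-identityˡ v)) (+-identityˡ v)
  select false u v = trans (cong₂ _+_ (*-identityˡ u) (*-zeroˡ v)) (+-identityʳ u)

nonNeg-treePoly : ∀ {N} (t : Tree N) o → NonnegCoeffs (treePoly t o)
nonNeg-treePoly (leaf o′) o with eqOut o′ o
... | true  = nonNeg-term unitMonomial
... | false = []
nonNeg-treePoly (query i t₀ t₁) o =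
  ++⁺ (nonNeg-*ₚ (nonNeg-term (negativeLiteral i)) (nonNeg-treePoly t₀ o))
      (nonNeg-*ₚ (nonNeg-term (positiveLiteral i)) (nonNeg-treePoly t₁ o))

degree-treePoly : ∀ {N} (t : Tree N) o → PolyDegreeAtMost (depth t) (treePoly t o)
degree-treePoly {N} (leaf o′) o with eqOut o′ o
... | true  = ℕₚ.≤-reflexive (monDegree-unitMonomial {N}) ∷ []
... | false = []
degree-treePoly (query i t₀ t₁) o =
  ++⁺ (degree-mono (s≤s (ℕₚ.m≤m⊔n (depth t₀) (depth t₁))) (branch (negativeLiteral i) t₀ (monDegree-negativeLiteral i)))
      (degree-mono (s≤s (ℕₚ.m≤n⊔m (depth t₀) (depth t₁))) (branch (positiveLiteral i) t₁ (monDegree-positiveLiteral i)))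
  where
  branch : ∀ m t → monDegree m ≡ 1 → PolyDegreeAtMost (suc (depth t)) (term m *ₚ treePoly t o)
  branch m t deg≡1 = degree-*ₚ (subst (λ d → PolyDegreeAtMost d (term m)) deg≡1 (degree-term m)) (degree-treePoly t o)

outputPoly : ∀ {N} → Alg N → Maybe Bool → Poly N
outputPoly []            o = []
outputPoly ((w , t) ∷ A) o = scale w (treePoly t o) ++ outputPoly A o

evalPoly-outputPoly : ∀ {N} (A : Alg N) o x → evalPoly (outputPoly A o) x ≡ probOut A x o
evalPoly-outputPoly []            o x = refl
evalPoly-outputPoly ((w , t) ∷ A) o x = begin
  evalPoly (scale w (treePoly t o) ++ outputPoly A o) x
    ≡⟨ evalPoly-++ (scale w (treePoly t o)) (outputPoly A o) x ⟩
  evalPoly (scale w (treePoly t o)) x + evalPoly (outputPoly A o) x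
    ≡⟨ cong₂ _+_ (evalPoly-scale w (treePoly t o) x) (evalPoly-outputPoly A o x) ⟩
  w * evalPoly (treePoly t o) x + probOut A x o
    ≡⟨ cong (λ e → w * e + probOut A x o) (evalPoly-treePoly t o x) ⟩
  w * b2q (eqOut (run t x) o) + probOut A x o
    ≡⟨ cong (_+ probOut A x o) (p*b2q[b]≡if w (eqOut (run t x) o)) ⟩
  probOut ((w , t) ∷ A) x o ∎
  where open ≡-Reasoning

Weights : ∀ {N} → (ℚ → Set) → Alg N → Set
Weights P A = All (λ p → P (proj₁ p)) A

nonNeg-outputPoly : ∀ {N} (A : Alg N) o → Weights (0ℚ ≤_) A → NonnegCoeffs (outputPoly A o)
nonNeg-outputPoly []            o []          = []
nonNeg-outputPoly ((w , t) ∷ A) o (0≤w ∷ nn) =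
  ++⁺ (nonNeg-scale 0≤w (nonNeg-treePoly t o)) (nonNeg-outputPoly A o nn)

degree-outputPoly : ∀ {N T} (A : Alg N) o → ComplexityAtMost T A → PolyDegreeAtMost T (outputPoly A o)
degree-outputPoly []            o []              = []
degree-outputPoly ((w , t) ∷ A) o (depth≤T ∷ cx) =
  ++⁺ (degree-scale {k = w} (degree-mono depth≤T (degree-treePoly t o))) (degree-outputPoly A o cx)

0≤if : ∀ {w} → 0ℚ ≤ w → ∀ b → 0ℚ ≤ (if b then w else 0ℚ)
0≤if 0≤w true  = 0≤w
0≤if 0≤w false = ≤-refl

0≤probOut : ∀ {N} (A : Alg N) x o → Weights (0ℚ ≤_) A → 0ℚ ≤ probOut A x o
0≤probOut []            x o []          = ≤-refl
0≤probOut ((w , t) ∷ A) x o (0≤w ∷ nn) = 0≤p+q (0≤if 0≤w (eqOut (run t x) o)) (0≤probOut A x o nn)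

0≤probDefined : ∀ {N} (A : Alg N) x → Weights (0ℚ ≤_) A → 0ℚ ≤ probDefined A x
0≤probDefined []            x []          = ≤-refl
0≤probDefined ((w , t) ∷ A) x (0≤w ∷ nn) = 0≤p+q (0≤if 0≤w (isDefined (run t x))) (0≤probDefined A x nn)

probDefined≡probOut₁+probOut₀ : ∀ {N} (A : Alg N) x →
  probDefined A x ≡ probOut A x (just true) + probOut A x (just false)
probDefined≡probOut₁+probOut₀ []            x = refl
probDefined≡probOut₁+probOut₀ ((w , t) ∷ A) x =
  trans (cong₂ _+_ (split (run t x)) (probDefined≡probOut₁+probOut₀ A x))
        (+-interchange (weightIf (just true)) (weightIf (just false))
                       (probOut A x (just true)) (probOut A x (just false)))
  where
  weightIf : Maybe Bool → ℚ
  weightIf o = if eqOut (run t x) o then w else 0ℚ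
  split : ∀ r → (if isDefined r then w else 0ℚ)
              ≡ (if eqOut r (just true) then w else 0ℚ) + (if eqOut r (just false) then w else 0ℚ)
  split nothing      = refl
  split (just true)  = sym (+-identityʳ w)
  split (just false) = sym (+-identityˡ w)

probOut-sum≡totalWeight : ∀ {N} (A : Alg N) x →
  probOut A x (just true) + probOut A x (just false) + probOut A x nothing ≡ totalWeight A
probOut-sum≡totalWeight []            x = refl
probOut-sum≡totalWeight ((w , t) ∷ A) x =
  trans (regroup (weightIf (just true)) (weightIf (just false)) (weightIf nothing)
                 (probOut A x (just true)) (probOut A x (just false)) (probOut A x nothing))
        (cong₂ _+_ (total (run t x)) (probOut-sum≡totalWeight A x))
  where
  weightIf : Maybe Bool → ℚ
  weightIf o = if eqOut (run t x) o then w else 0ℚ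
  regroup : ∀ a b c a′ b′ c′ → (a + a′) + (b + b′) + (c + c′) ≡ (a + b + c) + (a′ + b′ + c′)
  regroup = solve-∀ ℚ-ring
  total : ∀ r → (if eqOut r (just true) then w else 0ℚ) + (if eqOut r (just false) then w else 0ℚ)
                + (if eqOut r nothing then w else 0ℚ) ≡ w
  total nothing      = +-identityˡ w
  total (just true)  = trans (+-identityʳ (w + 0ℚ)) (+-identityʳ w)
  total (just false) = trans (+-identityʳ (0ℚ + w)) (+-identityˡ w)

minWeight : ∀ {N} → Alg N → ℚ
minWeight []            = 1ℚ
minWeight ((w , _) ∷ A) = w ⊓ minWeight A

0<minWeight : ∀ {N} (A : Alg N) → Weights (0ℚ <_) A → 0ℚ < minWeight A
0<minWeight []            []          = positive⁻¹ 1ℚ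
0<minWeight ((w , t) ∷ A) (0<w ∷ pos) with ⊓-sel w (minWeight A)
... | inj₁ min≡w = subst (0ℚ <_) (sym min≡w) 0<w
... | inj₂ min≡m = subst (0ℚ <_) (sym min≡m) (0<minWeight A pos)

minWeight≤1 : ∀ {N} (A : Alg N) → minWeight A ≤ 1ℚ
minWeight≤1 []            = ≤-refl
minWeight≤1 ((w , t) ∷ A) = ≤-trans (p⊓q≤q w (minWeight A)) (minWeight≤1 A)

minWeight≤probDefined : ∀ {N} (A : Alg N) x → Weights (0ℚ <_) A →
  0ℚ < probDefined A x → minWeight A ≤ probDefined A x
minWeight≤probDefined []            x []          0<0 = ⊥-elim (<-irrefl refl 0<0)
minWeight≤probDefined ((w , t) ∷ A) x (0<w ∷ pos) 0<pd with isDefined (run t x)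
... | true  = ≤-trans (p⊓q≤p w (minWeight A))
                      (subst (_≤ w + probDefined A x) (+-identityʳ w)
                             (+-monoʳ-≤ w (0≤probDefined A x (All.map <⇒≤ pos))))
... | false = ≤-trans (p⊓q≤q w (minWeight A))
                      (subst (minWeight A ≤_) (sym (+-identityˡ (probDefined A x)))
                             (minWeight≤probDefined A x pos (subst (0ℚ <_) (+-identityˡ (probDefined A x)) 0<pd)))

module Margins (ε : ℚ) (0<ε : 0ℚ < ε) (ε<½ : ε < ½) where

  0≤ε : 0ℚ ≤ ε
  0≤ε = <⇒≤ 0<ε

  0<1-2ε : 0ℚ < 1ℚ - ε - ε
  0<1-2ε = subst (0ℚ <_) (halves ε) (+-mono-< (p<q⇒0<q-p ε<½) (p<q⇒0<q-p ε<½))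
    where
    halves : ∀ ε → ½ - ε + (½ - ε) ≡ 1ℚ - ε - ε
    halves = solve-∀ ℚ-ring

  0<1-ε : 0ℚ < 1ℚ - ε
  0<1-ε = subst (0ℚ <_) (regroup ε) (0<p+q 0≤ε 0<1-2ε)
    where
    regroup : ∀ ε → ε + (1ℚ - ε - ε) ≡ 1ℚ - ε
    regroup = solve-∀ ℚ-ring

  0≤1-ε : 0ℚ ≤ 1ℚ - ε
  0≤1-ε = <⇒≤ 0<1-ε

  0≤1+ε : 0ℚ ≤ 1ℚ + ε
  0≤1+ε = 0≤p+q (nonNegative⁻¹ 1ℚ) 0≤ε

module RatioBounds (ε w : ℚ) (0<ε : 0ℚ < ε) (ε<½ : ε < ½) (0<w : 0ℚ < w) (w≤1 : w ≤ 1ℚ) where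
  open Margins ε 0<ε ε<½

  δ : ℚ
  δ = ε * (1ℚ - ε - ε) * w

  0<δ : 0ℚ < δ
  0<δ = 0<p*q (0<p*q 0<ε 0<1-2ε) 0<w

  numerator : ℚ → ℚ
  numerator p₁ = (1ℚ - ε) * (1ℚ + ε) * p₁

  denominator : ℚ → ℚ → ℚ → ℚ
  denominator p₁ p₀ p⊥ = (1ℚ - ε) * p₁ + (p₀ + δ * p⊥)

  module _ {p₁ p₀ p⊥ : ℚ} (0≤p₁ : 0ℚ ≤ p₁) (0≤p₀ : 0ℚ ≤ p₀) (0≤p⊥ : 0ℚ ≤ p⊥) where

    0≤numerator : 0ℚ ≤ numerator p₁
    0≤numerator = 0≤p*q (0≤p*q 0≤1-ε 0≤1+ε) 0≤p₁

    0≤denominator : 0ℚ ≤ denominator p₁ p₀ p⊥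
    0≤denominator = 0≤p+q (0≤p*q 0≤1-ε 0≤p₁) (0≤p+q 0≤p₀ (0≤p*q (<⇒≤ 0<δ) 0≤p⊥))

    numerator≤[1+ε]denominator : numerator p₁ ≤ (1ℚ + ε) * denominator p₁ p₀ p⊥
    numerator≤[1+ε]denominator =
      ≤-by-difference ((1ℚ + ε) * p₀ + (1ℚ + ε) * δ * p⊥) (identity ε δ p₁ p₀ p⊥)
        (0≤p+q (0≤p*q 0≤1+ε 0≤p₀) (0≤p*q (0≤p*q 0≤1+ε (<⇒≤ 0<δ)) 0≤p⊥))
      where
      identity : ∀ ε δ p₁ p₀ p⊥ → (1ℚ + ε) * ((1ℚ - ε) * p₁ + (p₀ + δ * p⊥)) - (1ℚ - ε) * (1ℚ + ε) * p₁
                                ≡ (1ℚ + ε) * p₀ + (1ℚ + ε) * δ * p⊥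
      identity = solve-∀ ℚ-ring

    [0-ε]denominator≤numerator : (0ℚ - ε) * denominator p₁ p₀ p⊥ ≤ numerator p₁
    [0-ε]denominator≤numerator =
      ≤-by-difference (numerator p₁ + ε * denominator p₁ p₀ p⊥) (identity ε (numerator p₁) (denominator p₁ p₀ p⊥))
        (0≤p+q 0≤numerator (0≤p*q 0≤ε 0≤denominator))
      where
      identity : ∀ ε n d → n - (0ℚ - ε) * d ≡ n + ε * d
      identity = solve-∀ ℚ-ring

    numerator≤[0+ε]denominator : (1ℚ - ε) * (p₁ + p₀) ≤ p₀ → numerator p₁ ≤ (0ℚ + ε) * denominator p₁ p₀ p⊥
    numerator≤[0+ε]denominator rejects =
      ≤-by-difference ((p₀ - (1ℚ - ε) * (p₁ + p₀)) + ε * δ * p⊥) (identity ε δ p₁ p₀ p⊥)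
        (0≤p+q (p≤q⇒0≤q-p rejects) (0≤p*q (0≤p*q 0≤ε (<⇒≤ 0<δ)) 0≤p⊥))
      where
      identity : ∀ ε δ p₁ p₀ p⊥ → (0ℚ + ε) * ((1ℚ - ε) * p₁ + (p₀ + δ * p⊥)) - (1ℚ - ε) * (1ℚ + ε) * p₁
                                ≡ (p₀ - (1ℚ - ε) * (p₁ + p₀)) + ε * δ * p⊥
      identity = solve-∀ ℚ-ring

  module _ {p₁ p₀ p⊥ : ℚ} (total : p₁ + p₀ + p⊥ ≡ 1ℚ) where

    p⊥≡1-p₁-p₀ : p⊥ ≡ 1ℚ - p₁ - p₀
    p⊥≡1-p₁-p₀ = trans (isolate p₁ p₀ p⊥) (cong (λ t → t - p₁ - p₀) total)
      where
      isolate : ∀ p₁ p₀ p⊥ → p⊥ ≡ p₁ + p₀ + p⊥ - p₁ - p₀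
      isolate = solve-∀ ℚ-ring

    δ≤denominator : 0ℚ ≤ p₁ → 0ℚ ≤ p₀ → δ ≤ denominator p₁ p₀ p⊥
    δ≤denominator 0≤p₁ 0≤p₀ =
      ≤-by-difference (K * p₁ + (K + ε) * p₀)
        (trans (cong (λ r → denominator p₁ p₀ r - δ) p⊥≡1-p₁-p₀) (identity ε w p₁ p₀))
        (0≤p+q (0≤p*q 0≤K 0≤p₁) (0≤p*q (0≤p+q 0≤K 0≤ε) 0≤p₀))
      where
      K : ℚ
      K = (1ℚ - ε - ε) + ε * ((1ℚ - w) + (ε + ε) * w)
      0≤K : 0ℚ ≤ K
      0≤K = 0≤p+q (<⇒≤ 0<1-2ε) (0≤p*q 0≤ε (0≤p+q (p≤q⇒0≤q-p w≤1) (0≤p*q (0≤p+q 0≤ε 0≤ε) (<⇒≤ 0<w))))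
      identity : ∀ ε w p₁ p₀ →
        (1ℚ - ε) * p₁ + (p₀ + ε * (1ℚ - ε - ε) * w * (1ℚ - p₁ - p₀)) - ε * (1ℚ - ε - ε) * w
          ≡ ((1ℚ - ε - ε) + ε * ((1ℚ - w) + (ε + ε) * w)) * p₁
            + ((1ℚ - ε - ε) + ε * ((1ℚ - w) + (ε + ε) * w) + ε) * p₀
      identity = solve-∀ ℚ-ring

    [1-ε]denominator≤numerator : w ≤ p₁ + p₀ → (1ℚ - ε) * (p₁ + p₀) ≤ p₁ →
      (1ℚ - ε) * denominator p₁ p₀ p⊥ ≤ numerator p₁
    [1-ε]denominator≤numerator w≤p₁+p₀ accepts =
      ≤-by-difference ((1ℚ - ε) * ((1ℚ + (ε + ε)) * acceptSlack + ε * (1ℚ - ε - ε) * weightSlack))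
        (trans (cong (λ r → numerator p₁ - (1ℚ - ε) * denominator p₁ p₀ r) p⊥≡1-p₁-p₀) (identity ε w p₁ p₀))
        (0≤p*q 0≤1-ε (0≤p+q (0≤p*q (0≤p+q (nonNegative⁻¹ 1ℚ) (0≤p+q 0≤ε 0≤ε)) (p≤q⇒0≤q-p accepts))
                            (0≤p*q (0≤p*q 0≤ε (<⇒≤ 0<1-2ε)) 0≤weightSlack)))
      where
      acceptSlack weightSlack : ℚ
      acceptSlack = p₁ - (1ℚ - ε) * (p₁ + p₀)
      weightSlack = (p₁ + p₀ - w) + w * (p₁ + p₀)
      0≤weightSlack : 0ℚ ≤ weightSlack
      0≤weightSlack = 0≤p+q (p≤q⇒0≤q-p w≤p₁+p₀) (0≤p*q (<⇒≤ 0<w) (≤-trans (<⇒≤ 0<w) w≤p₁+p₀))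
      identity : ∀ ε w p₁ p₀ →
        (1ℚ - ε) * (1ℚ + ε) * p₁ - (1ℚ - ε) * ((1ℚ - ε) * p₁ + (p₀ + ε * (1ℚ - ε - ε) * w * (1ℚ - p₁ - p₀)))
          ≡ (1ℚ - ε) * ((1ℚ + (ε + ε)) * (p₁ - (1ℚ - ε) * (p₁ + p₀))
                        + ε * (1ℚ - ε - ε) * ((p₁ + p₀ - w) + w * (p₁ + p₀)))
      identity = solve-∀ ℚ-ring

module AlgorithmToRational {N} (ε : ℚ) (0<ε : 0ℚ < ε) (ε<½ : ε < ½)
    (A : Alg N) (0<weights : Weights (0ℚ <_) A) (total : totalWeight A ≡ 1ℚ) where
  open Margins ε 0<ε ε<½
  open RatioBounds ε (minWeight A) 0<ε ε<½ (0<minWeight A 0<weights) (minWeight≤1 A)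

  0≤weights : Weights (0ℚ ≤_) A
  0≤weights = All.map <⇒≤ 0<weights

  p₁ p₀ p⊥ : Input N → ℚ
  p₁ x = probOut A x (just true)
  p₀ x = probOut A x (just false)
  p⊥ x = probOut A x nothing

  P Q : Poly N
  P = scale ((1ℚ - ε) * (1ℚ + ε)) (outputPoly A (just true))
  Q = scale (1ℚ - ε) (outputPoly A (just true)) ++ (outputPoly A (just false) ++ scale δ (outputPoly A nothing))

  evalPoly-P : ∀ x → evalPoly P x ≡ numerator (p₁ x)
  evalPoly-P x = trans (evalPoly-scale ((1ℚ - ε) * (1ℚ + ε)) (outputPoly A (just true)) x)
                       (cong ((1ℚ - ε) * (1ℚ + ε) *_) (evalPoly-outputPoly A (just true) x))

  evalPoly-Q : ∀ x → evalPoly Q x ≡ denominator (p₁ x) (p₀ x) (p⊥ x)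
  evalPoly-Q x = begin
    evalPoly Q x
      ≡⟨ evalPoly-++ (scale (1ℚ - ε) (outputPoly A (just true))) _ x ⟩
    evalPoly (scale (1ℚ - ε) (outputPoly A (just true))) x
      + evalPoly (outputPoly A (just false) ++ scale δ (outputPoly A nothing)) x
      ≡⟨ cong (evalPoly (scale (1ℚ - ε) (outputPoly A (just true))) x +_)
              (evalPoly-++ (outputPoly A (just false)) (scale δ (outputPoly A nothing)) x) ⟩
    evalPoly (scale (1ℚ - ε) (outputPoly A (just true))) x
      + (evalPoly (outputPoly A (just false)) x + evalPoly (scale δ (outputPoly A nothing)) x)
      ≡⟨ cong₂ (λ a b → a + (evalPoly (outputPoly A (just false)) x + b))
               (evalPoly-scale (1ℚ - ε) (outputPoly A (just true)) x) (evalPoly-scale δ (outputPoly A nothing) x) ⟩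
    (1ℚ - ε) * evalPoly (outputPoly A (just true)) x
      + (evalPoly (outputPoly A (just false)) x + δ * evalPoly (outputPoly A nothing) x)
      ≡⟨ cong₂ (λ a b → (1ℚ - ε) * a + b) (evalPoly-outputPoly A (just true) x)
               (cong₂ (λ a b → a + δ * b) (evalPoly-outputPoly A (just false) x) (evalPoly-outputPoly A nothing x)) ⟩
    denominator (p₁ x) (p₀ x) (p⊥ x) ∎
    where open ≡-Reasoning

  0≤p₁ : ∀ x → 0ℚ ≤ p₁ x
  0≤p₁ x = 0≤probOut A x (just true) 0≤weights

  0≤p₀ : ∀ x → 0ℚ ≤ p₀ x
  0≤p₀ x = 0≤probOut A x (just false) 0≤weights

  0≤p⊥ : ∀ x → 0ℚ ≤ p⊥ x
  0≤p⊥ x = 0≤probOut A x nothing 0≤weights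

  0<evalPoly-Q : ∀ x → 0ℚ < evalPoly Q x
  0<evalPoly-Q x = subst (0ℚ <_) (sym (evalPoly-Q x))
    (<-≤-trans 0<δ (δ≤denominator (trans (probOut-sum≡totalWeight A x) total) (0≤p₁ x) (0≤p₀ x)))

  Q≢0 : ∀ x → evalPoly Q x ≢ 0ℚ
  Q≢0 x Q≡0 = <⇒≢ (0<evalPoly-Q x) (sym Q≡0)

  nonNeg-P : NonnegCoeffs P
  nonNeg-P = nonNeg-scale (0≤p*q 0≤1-ε 0≤1+ε) (nonNeg-outputPoly A (just true) 0≤weights)

  nonNeg-Q : NonnegCoeffs Q
  nonNeg-Q = ++⁺ (nonNeg-scale 0≤1-ε (nonNeg-outputPoly A (just true) 0≤weights))
                 (++⁺ (nonNeg-outputPoly A (just false) 0≤weights)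
                      (nonNeg-scale (<⇒≤ 0<δ) (nonNeg-outputPoly A nothing 0≤weights)))

  module _ {T : ℕ} (cx : ComplexityAtMost T A) where

    degree-P : PolyDegreeAtMost T P
    degree-P = degree-scale {k = (1ℚ - ε) * (1ℚ + ε)} (degree-outputPoly A (just true) cx)

    degree-Q : PolyDegreeAtMost T Q
    degree-Q = ++⁺ (degree-scale {k = 1ℚ - ε} (degree-outputPoly A (just true) cx))
                   (++⁺ (degree-outputPoly A (just false) cx) (degree-scale {k = δ} (degree-outputPoly A nothing cx)))

  R : Input N → ℚ
  R x = (evalPoly P x ÷ evalPoly Q x) {{≢-nonZero (Q≢0 x)}}

  within : ∀ x {q r} → (q - r) * denominator (p₁ x) (p₀ x) (p⊥ x) ≤ numerator (p₁ x) →
    numerator (p₁ x) ≤ (q + r) * denominator (p₁ x) (p₀ x) (p⊥ x) → ∣ R x - q ∣ ≤ r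
  within x {q} {r} lower upper =
    [q-r]s≤p≤[q+r]s⇒∣p÷s-q∣≤r {{≢-nonZero (Q≢0 x)}} (0<evalPoly-Q x)
      (subst₂ (λ n d → (q - r) * d ≤ n) (sym (evalPoly-P x)) (sym (evalPoly-Q x)) lower)
      (subst₂ (λ n d → n ≤ (q + r) * d) (sym (evalPoly-P x)) (sym (evalPoly-Q x)) upper)

  approximates : ∀ x b → 0ℚ < p₁ x + p₀ x → (1ℚ - ε) * (p₁ x + p₀ x) ≤ probOut A x (just b) →
    ∣ R x - b2q b ∣ ≤ ε
  approximates x true 0<p₁+p₀ accepts =
    within x {1ℚ} ([1-ε]denominator≤numerator (trans (probOut-sum≡totalWeight A x) total) w≤p₁+p₀ accepts)
             (numerator≤[1+ε]denominator (0≤p₁ x) (0≤p₀ x) (0≤p⊥ x))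
    where
    w≤p₁+p₀ : minWeight A ≤ p₁ x + p₀ x
    w≤p₁+p₀ = subst (minWeight A ≤_) (probDefined≡probOut₁+probOut₀ A x)
      (minWeight≤probDefined A x 0<weights (subst (0ℚ <_) (sym (probDefined≡probOut₁+probOut₀ A x)) 0<p₁+p₀))
  approximates x false _ rejects =
    within x {0ℚ} ([0-ε]denominator≤numerator (0≤p₁ x) (0≤p₀ x) (0≤p⊥ x))
             (numerator≤[0+ε]denominator (0≤p₁ x) (0≤p₀ x) (0≤p⊥ x) rejects)


  approximation : ∀ {D} (f : PartialFun N D) → Computes A f ε → ∀ x dx → ∣ R x - b2q (f x dx) ∣ ≤ ε
  approximation f computes x dx =
    approximates x (f x dx) (subst (0ℚ <_) split 0<pd)
      (subst (λ s → (1ℚ - ε) * s ≤ probOut A x (just (f x dx))) split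
             (≤÷⇒*≤ {{≢-nonZero (λ pd≡0 → <⇒≢ 0<pd (sym pd≡0))}} 0<pd (proj₂ (computes x dx))))
    where
    0<pd : 0ℚ < probDefined A x
    0<pd = proj₁ (computes x dx)
    split : probDefined A x ≡ p₁ x + p₀ x
    split = probDefined≡probOut₁+probOut₀ A x

postR⇒rdeg : ∀ {N} {D : Input N → Set} (f : PartialFun N D) ε → 0ℚ < ε → ε < ½ →
  ∀ T → PostRAtMost f ε T → RdegAtMost f ε T
postR⇒rdeg f ε 0<ε ε<½ T (A , (0<weights , total) , cx , computes) =
  P , Q , nonNeg-P , nonNeg-Q , degree-P cx , degree-Q cx , Q≢0 , approximation f computes
  where open AlgorithmToRational ε 0<ε ε<½ A 0<weights total

-- From rational functions to algorithms

totalWeight-++ : ∀ {N} (A B : Alg N) → totalWeight (A ++ B) ≡ totalWeight A + totalWeight B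
totalWeight-++ []            B = sym (+-identityˡ (totalWeight B))
totalWeight-++ ((w , t) ∷ A) B =
  trans (cong (w +_) (totalWeight-++ A B)) (sym (+-assoc w (totalWeight A) (totalWeight B)))

probOut-++ : ∀ {N} (A B : Alg N) x o → probOut (A ++ B) x o ≡ probOut A x o + probOut B x o
probOut-++ []            B x o = sym (+-identityˡ (probOut B x o))
probOut-++ ((w , t) ∷ A) B x o =
  trans (cong (weight +_) (probOut-++ A B x o)) (sym (+-assoc weight (probOut A x o) (probOut B x o)))
  where
  weight : ℚ
  weight = if eqOut (run t x) o then w else 0ℚ

guardLiteral : ∀ {N} → (inS inT : Bool) → Fin N → Tree N → Tree N
guardLiteral false false i u = u
guardLiteral true  false i u = query i (leaf nothing) u
guardLiteral false true  i u = query i u (leaf nothing)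
guardLiteral true  true  i u = leaf nothing

run-guardLiteral : ∀ {N} s t (i : Fin N) u x →
  run (guardLiteral s t i u) x ≡ (if literalHolds s t (x i) then run u x else nothing)
run-guardLiteral false false i u x rewrite literalHolds-absent (x i) = refl
run-guardLiteral true  false i u x with x i
... | true  = refl
... | false = refl
run-guardLiteral false true  i u x with x i
... | true  = refl
... | false = refl
run-guardLiteral true  true  i u x with x i
... | true  = refl
... | false = refl

depth-guardLiteral : ∀ {n N} s t (S T : Subset n) (i : Fin N) u → depth u ℕ.≤ size S ℕ.+ size T →
  depth (guardLiteral s t i u) ℕ.≤ size (s ∷ S) ℕ.+ size (t ∷ T)
depth-guardLiteral false false S T i u h = h
depth-guardLiteral true  false S T i u h = s≤s h
depth-guardLiteral false true  S T i u h =
  subst₂ ℕ._≤_ (cong suc (sym (ℕₚ.⊔-identityʳ (depth u)))) (sym (ℕₚ.+-suc (size S) (size T))) (s≤s h)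
depth-guardLiteral true  true  S T i u h = z≤n

monomialTree : ∀ {n N} → (Fin n → Fin N) → Monomial n → Maybe Bool → Tree N
monomialTree {zero}  ι _               o = leaf o
monomialTree {suc n} ι (s ∷ S , t ∷ T) o = guardLiteral s t (ι zero) (monomialTree (ι ∘ suc) (S , T) o)

run-monomialTree : ∀ {n N} (ι : Fin n → Fin N) m o x →
  run (monomialTree ι m o) x ≡ (if satisfies m (x ∘ ι) then o else nothing)
run-monomialTree {zero}  ι m               o x = refl
run-monomialTree {suc n} ι (s ∷ S , t ∷ T) o x = begin
  run (guardLiteral s t (ι zero) (monomialTree (ι ∘ suc) (S , T) o)) x
    ≡⟨ run-guardLiteral s t (ι zero) (monomialTree (ι ∘ suc) (S , T) o) x ⟩
  (if holds then run (monomialTree (ι ∘ suc) (S , T) o) x else nothing)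
    ≡⟨ cong (λ r → if holds then r else nothing) (run-monomialTree (ι ∘ suc) (S , T) o x) ⟩
  (if holds then (if satisfies (S , T) (x ∘ ι ∘ suc) then o else nothing) else nothing)
    ≡⟨ if-∧ holds ⟨
  (if satisfies (s ∷ S , t ∷ T) (x ∘ ι) then o else nothing) ∎
  where
  open ≡-Reasoning
  holds : Bool
  holds = literalHolds s t (x (ι zero))

depth-monomialTree : ∀ {n N} (ι : Fin n → Fin N) m o → depth (monomialTree ι m o) ℕ.≤ monDegree m
depth-monomialTree {zero}  ι m               o = z≤n
depth-monomialTree {suc n} ι (s ∷ S , t ∷ T) o =
  depth-guardLiteral s t S T (ι zero) (monomialTree (ι ∘ suc) (S , T) o) (depth-monomialTree (ι ∘ suc) (S , T) o)

monomialTrees : ∀ {N} → Poly N → Maybe Bool → Alg N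
monomialTrees P o = map (map₂ (λ m → monomialTree id m o)) P

weight-monomialTree : ∀ {N} c (m : Monomial N) o b x →
  (if eqOut (run (monomialTree id m o) x) (just b) then c else 0ℚ)
    ≡ (if eqOut o (just b) then c * evalMon m x else 0ℚ)
weight-monomialTree c m o b x = begin
  (if eqOut (run (monomialTree id m o) x) (just b) then c else 0ℚ)
    ≡⟨ cong (λ r → if eqOut r (just b) then c else 0ℚ) (run-monomialTree id m o x) ⟩
  (if eqOut (if satisfies m x then o else nothing) (just b) then c else 0ℚ)
    ≡⟨ guarded (satisfies m x) ⟩
  (if eqOut o (just b) then c * b2q (satisfies m x) else 0ℚ)
    ≡⟨ cong (λ e → if eqOut o (just b) then c * e else 0ℚ) (evalMon≡b2q∘satisfies m x) ⟨
  (if eqOut o (just b) then c * evalMon m x else 0ℚ) ∎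
  where
  open ≡-Reasoning
  guarded : ∀ s → (if eqOut (if s then o else nothing) (just b) then c else 0ℚ)
                ≡ (if eqOut o (just b) then c * b2q s else 0ℚ)
  guarded true  = cong (λ e → if eqOut o (just b) then e else 0ℚ) (sym (*-identityʳ c))
  guarded false rewrite *-zeroʳ c = sym (if-eta (eqOut o (just b)))

if-+ : ∀ b p q → (if b then p else 0ℚ) + (if b then q else 0ℚ) ≡ (if b then p + q else 0ℚ)
if-+ true  p q = refl
if-+ false p q = refl

probOut-monomialTrees : ∀ {N} (P : Poly N) o b x →
  probOut (monomialTrees P o) x (just b) ≡ (if eqOut o (just b) then evalPoly P x else 0ℚ)
probOut-monomialTrees []            o b x = sym (if-eta (eqOut o (just b)))
probOut-monomialTrees ((c , m) ∷ P) o b x =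
  trans (cong₂ _+_ (weight-monomialTree c m o b x) (probOut-monomialTrees P o b x))
        (if-+ (eqOut o (just b)) (c * evalMon m x) (evalPoly P x))

totalWeight-monomialTrees : ∀ {N} (P : Poly N) o → totalWeight (monomialTrees P o) ≡ coeffSum P
totalWeight-monomialTrees []            o = refl
totalWeight-monomialTrees ((c , m) ∷ P) o = cong (c +_) (totalWeight-monomialTrees P o)

complexity-monomialTrees : ∀ {N d} (P : Poly N) o → PolyDegreeAtMost d P → ComplexityAtMost d (monomialTrees P o)
complexity-monomialTrees P o degP =
  map⁺ (All.map (λ {(_ , m)} deg≤d → ℕₚ.≤-trans (depth-monomialTree id m o) deg≤d) degP)

-- The weights of an algorithm must be positive.
dropZeroTerms : ∀ {N} → Poly N → Poly N
dropZeroTerms = filter (λ (c , _) → ¬? (c ≟ 0ℚ))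

evalPoly-dropZeroTerms : ∀ {N} (P : Poly N) x → evalPoly (dropZeroTerms P) x ≡ evalPoly P x
evalPoly-dropZeroTerms []            x = refl
evalPoly-dropZeroTerms ((c , m) ∷ P) x with c ≟ 0ℚ
... | yes refl = trans (evalPoly-dropZeroTerms P x)
                       (sym (trans (cong (_+ evalPoly P x) (*-zeroˡ (evalMon m x))) (+-identityˡ (evalPoly P x))))
... | no _     = cong (c * evalMon m x +_) (evalPoly-dropZeroTerms P x)

coeffSum-dropZeroTerms : ∀ {N} (P : Poly N) → coeffSum (dropZeroTerms P) ≡ coeffSum P
coeffSum-dropZeroTerms []            = refl
coeffSum-dropZeroTerms ((c , m) ∷ P) with c ≟ 0ℚ
... | yes refl = trans (coeffSum-dropZeroTerms P) (sym (+-identityˡ (coeffSum P)))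
... | no _     = cong (c +_) (coeffSum-dropZeroTerms P)

positive-dropZeroTerms : ∀ {N} (P : Poly N) → NonnegCoeffs P → All (λ p → 0ℚ < proj₁ p) (dropZeroTerms P)
positive-dropZeroTerms P nonNeg =
  All.zipWith (λ (0≤c , c≢0) → 0≤p∧p≢0⇒0<p 0≤c c≢0) (filter⁺ _ nonNeg , all-filter _ P)

module SquareBounds (ε : ℚ) (0<ε : 0ℚ < ε) (ε<½ : ε < ½) where
  open Margins ε 0<ε ε<½

  ε′ : ℚ
  ε′ = ε * (1ℚ - ε)

  0<ε′ : 0ℚ < ε′
  0<ε′ = 0<p*q 0<ε 0<1-ε

  module _ {k p q : ℚ} (0≤k : 0ℚ ≤ k) (0≤p : 0ℚ ≤ p) (0≤q : 0ℚ ≤ q) where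

    accept-bound : (1ℚ - ε) * q ≤ p → (1ℚ - ε) * (k * (p * p) + k * (ε′ * (q * q))) ≤ k * (p * p)
    accept-bound [1-ε]q≤p =
      ≤-by-difference (k * ε * ((p - (1ℚ - ε) * q) * (p + (1ℚ - ε) * q))) (identity k ε p q)
        (0≤p*q (0≤p*q 0≤k 0≤ε) (0≤p*q (p≤q⇒0≤q-p [1-ε]q≤p) (0≤p+q 0≤p (0≤p*q 0≤1-ε 0≤q))))
      where
      identity : ∀ k ε p q → k * (p * p) - (1ℚ - ε) * (k * (p * p) + k * (ε * (1ℚ - ε) * (q * q)))
                           ≡ k * ε * ((p - (1ℚ - ε) * q) * (p + (1ℚ - ε) * q))
      identity = solve-∀ ℚ-ring

    reject-bound : p ≤ (0ℚ + ε) * q → (1ℚ - ε) * (k * (p * p) + k * (ε′ * (q * q))) ≤ k * (ε′ * (q * q))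
    reject-bound p≤εq =
      ≤-by-difference (k * (1ℚ - ε) * (((0ℚ + ε) * q - p) * ((0ℚ + ε) * q + p))) (identity k ε p q)
        (0≤p*q (0≤p*q 0≤k 0≤1-ε) (0≤p*q (p≤q⇒0≤q-p p≤εq) (0≤p+q (0≤p*q (0≤p+q ≤-refl 0≤ε) 0≤q) 0≤p)))
      where
      identity : ∀ k ε p q → k * (ε * (1ℚ - ε) * (q * q)) - (1ℚ - ε) * (k * (p * p) + k * (ε * (1ℚ - ε) * (q * q)))
                           ≡ k * (1ℚ - ε) * (((0ℚ + ε) * q - p) * ((0ℚ + ε) * q + p))
      identity = solve-∀ ℚ-ring

module RationalToAlgorithm {N} (ε : ℚ) (0<ε : 0ℚ < ε) (ε<½ : ε < ½)
    (P Q : Poly N) (nonNeg-P : NonnegCoeffs P) (nonNeg-Q : NonnegCoeffs Q) (Q≢0 : ∀ x → evalPoly Q x ≢ 0ℚ) where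
  open Margins ε 0<ε ε<½
  open SquareBounds ε 0<ε ε<½

  U V : Poly N
  U = P *ₚ P
  V = scale ε′ (Q *ₚ Q)

  nonNeg-U : NonnegCoeffs U
  nonNeg-U = nonNeg-*ₚ nonNeg-P nonNeg-P

  nonNeg-V : NonnegCoeffs V
  nonNeg-V = nonNeg-scale (<⇒≤ 0<ε′) (nonNeg-*ₚ nonNeg-Q nonNeg-Q)

  Z : ℚ
  Z = 1ℚ + (coeffSum U + coeffSum V)

  0<Z : 0ℚ < Z
  0<Z = +-mono-<-≤ (positive⁻¹ 1ℚ) (0≤p+q (0≤coeffSum U nonNeg-U) (0≤coeffSum V nonNeg-V))

  k : ℚ
  k = (1/ Z) {{pos⇒nonZero Z {{positive 0<Z}}}}

  0<k : 0ℚ < k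
  0<k = positive⁻¹ k {{1/pos⇒pos Z {{positive 0<Z}}}}

  trees : Poly N → Maybe Bool → Alg N
  trees R o = monomialTrees (dropZeroTerms (scale k R)) o

  A : Alg N
  A = (k , leaf nothing) ∷ trees U (just true) ++ trees V (just false)

  probOut-trees : ∀ R o b x → probOut (trees R o) x (just b) ≡ (if eqOut o (just b) then k * evalPoly R x else 0ℚ)
  probOut-trees R o b x =
    trans (probOut-monomialTrees (dropZeroTerms (scale k R)) o b x)
          (cong (λ e → if eqOut o (just b) then e else 0ℚ)
                (trans (evalPoly-dropZeroTerms (scale k R) x) (evalPoly-scale k R x)))

  totalWeight-trees : ∀ R o → totalWeight (trees R o) ≡ k * coeffSum R
  totalWeight-trees R o =
    trans (totalWeight-monomialTrees (dropZeroTerms (scale k R)) o)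
          (trans (coeffSum-dropZeroTerms (scale k R)) (coeffSum-scale k R))

  positive-trees : ∀ {R} o → NonnegCoeffs R → Weights (0ℚ <_) (trees R o)
  positive-trees {R} o nonNeg = map⁺ (positive-dropZeroTerms (scale k R) (nonNeg-scale (<⇒≤ 0<k) nonNeg))

  isDistribution : IsDistribution A
  isDistribution = 0<k ∷ ++⁺ (positive-trees (just true) nonNeg-U) (positive-trees (just false) nonNeg-V) , total
    where
    total : totalWeight A ≡ 1ℚ
    total = begin
      k + totalWeight (trees U (just true) ++ trees V (just false))
        ≡⟨ cong (k +_) (totalWeight-++ (trees U (just true)) (trees V (just false))) ⟩
      k + (totalWeight (trees U (just true)) + totalWeight (trees V (just false)))
        ≡⟨ cong (λ s → k + s) (cong₂ _+_ (totalWeight-trees U (just true)) (totalWeight-trees V (just false))) ⟩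
      k + (k * coeffSum U + k * coeffSum V)
        ≡⟨ factor k (coeffSum U) (coeffSum V) ⟩
      k * Z
        ≡⟨ *-inverseˡ Z {{pos⇒nonZero Z {{positive 0<Z}}}} ⟩
      1ℚ ∎
      where
      open ≡-Reasoning
      factor : ∀ k a b → k + (k * a + k * b) ≡ k * (1ℚ + (a + b))
      factor = solve-∀ ℚ-ring

  complexity : ∀ {d} → PolyDegreeAtMost d P → PolyDegreeAtMost d Q → ComplexityAtMost (2 ℕ.* d) A
  complexity {d} degree-P degree-Q =
    z≤n ∷ ++⁺ (complexity-trees (degree-*ₚ degree-P degree-P)) (complexity-trees (degree-scale {k = ε′} (degree-*ₚ degree-Q degree-Q)))
    where
    d+d≡2d : d ℕ.+ d ≡ 2 ℕ.* d
    d+d≡2d = cong (d ℕ.+_) (sym (ℕₚ.+-identityʳ d))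
    complexity-trees : ∀ {R o} → PolyDegreeAtMost (d ℕ.+ d) R → ComplexityAtMost (2 ℕ.* d) (trees R o)
    complexity-trees {R} {o} degree-R =
      complexity-monomialTrees (dropZeroTerms (scale k R)) o
        (filter⁺ _ (degree-scale {k = k} (subst (λ e → PolyDegreeAtMost e R) d+d≡2d degree-R)))

  probOut-accept : ∀ x → probOut A x (just true) ≡ k * (evalPoly P x * evalPoly P x)
  probOut-accept x = begin
    0ℚ + probOut (trees U (just true) ++ trees V (just false)) x (just true)
      ≡⟨ +-identityˡ _ ⟩
    probOut (trees U (just true) ++ trees V (just false)) x (just true)
      ≡⟨ probOut-++ (trees U (just true)) (trees V (just false)) x (just true) ⟩
    probOut (trees U (just true)) x (just true) + probOut (trees V (just false)) x (just true)
      ≡⟨ cong₂ _+_ (probOut-trees U (just true) true x) (probOut-trees V (just false) true x) ⟩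
    k * evalPoly U x + 0ℚ
      ≡⟨ +-identityʳ _ ⟩
    k * evalPoly U x
      ≡⟨ cong (k *_) (evalPoly-*ₚ P P x) ⟩
    k * (evalPoly P x * evalPoly P x) ∎
    where open ≡-Reasoning

  probOut-reject : ∀ x → probOut A x (just false) ≡ k * (ε′ * (evalPoly Q x * evalPoly Q x))
  probOut-reject x = begin
    0ℚ + probOut (trees U (just true) ++ trees V (just false)) x (just false)
      ≡⟨ +-identityˡ _ ⟩
    probOut (trees U (just true) ++ trees V (just false)) x (just false)
      ≡⟨ probOut-++ (trees U (just true)) (trees V (just false)) x (just false) ⟩
    probOut (trees U (just true)) x (just false) + probOut (trees V (just false)) x (just false)
      ≡⟨ cong₂ _+_ (probOut-trees U (just true) false x) (probOut-trees V (just false) false x) ⟩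
    0ℚ + k * evalPoly V x
      ≡⟨ +-identityˡ _ ⟩
    k * evalPoly V x
      ≡⟨ cong (k *_) (trans (evalPoly-scale ε′ (Q *ₚ Q) x) (cong (ε′ *_) (evalPoly-*ₚ Q Q x))) ⟩
    k * (ε′ * (evalPoly Q x * evalPoly Q x)) ∎
    where open ≡-Reasoning

  probDefined≡ : ∀ x → probDefined A x ≡ k * (evalPoly P x * evalPoly P x) + k * (ε′ * (evalPoly Q x * evalPoly Q x))
  probDefined≡ x =
    trans (probDefined≡probOut₁+probOut₀ A x) (cong₂ _+_ (probOut-accept x) (probOut-reject x))

  0<evalPoly-Q : ∀ x → 0ℚ < evalPoly Q x
  0<evalPoly-Q x = 0≤p∧p≢0⇒0<p (0≤evalPoly Q nonNeg-Q x) (Q≢0 x)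

  0<probDefined : ∀ x → 0ℚ < probDefined A x
  0<probDefined x = subst (0ℚ <_) (sym (probDefined≡ x))
    (0<p+q (0≤p*q (<⇒≤ 0<k) (0≤p*q (0≤evalPoly P nonNeg-P x) (0≤evalPoly P nonNeg-P x)))
           (0<p*q 0<k (0<p*q 0<ε′ (0<p*q (0<evalPoly-Q x) (0<evalPoly-Q x)))))

  R : Input N → ℚ
  R x = (evalPoly P x ÷ evalPoly Q x) {{≢-nonZero (Q≢0 x)}}

  conditional-bound : ∀ x b → ∣ R x - b2q b ∣ ≤ ε → (1ℚ - ε) * probDefined A x ≤ probOut A x (just b)
  conditional-bound x true  near1 =
    subst₂ (λ d a → (1ℚ - ε) * d ≤ a) (sym (probDefined≡ x)) (sym (probOut-accept x))
      (accept-bound (<⇒≤ 0<k) (0≤evalPoly P nonNeg-P x) (<⇒≤ (0<evalPoly-Q x))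
        (∣p÷s-q∣≤r⇒[q-r]s≤p {q = 1ℚ} {{≢-nonZero (Q≢0 x)}} (0<evalPoly-Q x) near1))
  conditional-bound x false near0 =
    subst₂ (λ d a → (1ℚ - ε) * d ≤ a) (sym (probDefined≡ x)) (sym (probOut-reject x))
      (reject-bound (<⇒≤ 0<k) (0≤evalPoly P nonNeg-P x) (<⇒≤ (0<evalPoly-Q x))
        (∣p÷s-q∣≤r⇒p≤[q+r]s {q = 0ℚ} {{≢-nonZero (Q≢0 x)}} (0<evalPoly-Q x) near0))

  computes : ∀ {D} (f : PartialFun N D) → (∀ x dx → ∣ R x - b2q (f x dx) ∣ ≤ ε) → Computes A f ε
  computes f approximates x dx =
    0<probDefined x ,
    *≤⇒≤÷ {{≢-nonZero (λ pd≡0 → <⇒≢ (0<probDefined x) (sym pd≡0))}} (0<probDefined x)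
      (conditional-bound x (f x dx) (approximates x dx))

rdeg⇒postR : ∀ {N} {D : Input N → Set} (f : PartialFun N D) ε → 0ℚ < ε → ε < ½ →
  ∀ d → RdegAtMost f ε d → PostRAtMost f ε (2 ℕ.* d)
rdeg⇒postR f ε 0<ε ε<½ d (P , Q , nonNeg-P , nonNeg-Q , degree-P , degree-Q , Q≢0 , approximates) =
  A , isDistribution , complexity degree-P degree-Q , computes f approximates
  where open RationalToAlgorithm ε 0<ε ε<½ P Q nonNeg-P nonNeg-Q Q≢0

theorem1 : (N : ℕ) → 1 ℕ.≤ N → (D : Input N → Set) → (f : PartialFun N D) →
    (ε : ℚ) → 0ℚ < ε → ε < ½ →
    ((T : ℕ) → PostRAtMost f ε T → RdegAtMost f ε T) ×
    ((d : ℕ) → RdegAtMost f ε d → PostRAtMost f ε (2 ℕ.* d))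
theorem1 N _ D f ε 0<ε ε<½ = postR⇒rdeg f ε 0<ε ε<½ , rdeg⇒postR f ε 0<ε ε<½
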